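{- Let $k\geq3$ and let $n\geq 4$ be even. Suppose $[a_0,a_1,\dots,a_{n-1}]$ is a negasymmetric circuit in $\mathcal{C}_k(n-1)$ with even period $c$ containing at least one negasymmetric $n$-tuple. Then $[a_0,a_1,\dots,a_{n-1}]$ contains precisely two negasymmetric $n$-tuples, and they are at distance $c/2$ apart (i.e. one is obtained from the other by cyclically shifting by $c/2$ positions).
   Context: Tuples are $k$-ary (entries in $\mathbb{Z}_k$), negation is modulo $k$, $\mathbf{u}^R$ is the reverse of $\mathbf{u}$; a tuple $\mathbf{u}$ is negasymmetric if $\mathbf{u}=-\mathbf{u}^R$. The pseudoweight of $a\in\mathbb{Z}_k$ is $a$ if $a\ne0$ and $k/2$ if $a=0$, and of a tuple the sum over its entries. $B_k(n-1)$ is the de Bruijn digraph with vertices the $k$-ary $(n-1)$-tuples and edges the $k$-ary $n$-tuples $(a_0,\dots,a_{n-1})$ from $(a_0,\dots,a_{n-2})$ to $(a_1,\dots,a_{n-1})$; $H_k(n-1)$ is its subgraph of edges of pseudoweight exactly $kn/2$. For an $n$-tuple $(a_0,\dots,a_{n-1})$, with $p$ the least positive $c'$ such that $a_i=a_{(i+c')\bmod n}$ for all $i$, $[a_0,\dots,a_{n-1}]$ is the circuit whose edges (the $n$-tuples it contains) are the $p$ cyclic shifts $(a_j,\dots,a_{j+n-1})$ (indices mod $n$), $0\le j<p$; $p$ is its period. $\mathcal{C}_k(n-1)$ is the set of such circuits arising from edges of $H_k(n-1)$. A circuit is negasymmetric if it contains edges $\mathbf a,\mathbf b$ (not necessarily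 distinct) with $\mathbf a=-\mathbf b^R$. -}

module Defs where

open import Data.Nat using (ℕ; zero; suc; _+_; _*_; _∸_; _<_; _≤_; _%_)
open import Data.Nat.DivMod using (m%n<n)
open import Data.Fin using (Fin; toℕ; fromℕ<)
open import Data.Vec using (Vec; map; reverse; tabulate; lookup; foldr)
open import Data.Product using (Σ; ∃; _×_)
open import Relation.Binary.PropositionalEquality using (_≡_)

-- k-ary n-tuples: entries in ℤ_k represented as Fin k
Tuple : ℕ → ℕ → Set
Tuple k n = Vec (Fin k) n

negZ : ∀ {k} → Fin k → Fin k
negZ {suc m} a = fromℕ< (m%n<n (suc m ∸ toℕ a) (suc m))

addMod : ∀ {n} → Fin n → ℕ → Fin n
addMod {suc m} i j = fromℕ< (m%n<n (toℕ i + j) (suc m))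

Negasym : ∀ {k n} → Tuple k n → Set
Negasym u = u ≡ map negZ (reverse u)

-- twice the pseudoweight of a ∈ ℤ_k : 2a if a ≠ 0, k if a = 0
pw2 : ∀ {k} → Fin k → ℕ
pw2 {k} Fin.zero = k
pw2 (Fin.suc i) = 2 * suc (toℕ i)

pwt2 : ∀ {k n} → Tuple k n → ℕ
pwt2 u = foldr (λ _ → ℕ) (λ a s → pw2 a + s) 0 u

-- edge of H_k(n-1): pseudoweight exactly kn/2, i.e. doubled pseudoweight = k*n
InH : ∀ {k n} → Tuple k n → Set
InH {k} {n} u = pwt2 u ≡ k * n

shift : ∀ {k n} → ℕ → Tuple k n → Tuple k n
shift j a = tabulate (λ i → lookup a (addMod i j))

Periodic : ∀ {k n} → Tuple k n → ℕ → Set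
Periodic {n = n} a c = ∀ (i : Fin n) → lookup a i ≡ lookup a (addMod i c)

IsPeriod : ∀ {k n} → Tuple k n → ℕ → Set
IsPeriod a p = (0 < p) × Periodic a p × (∀ c → 0 < c → Periodic a c → p ≤ c)

-- edges of the circuit [a] of period p: the shifts by j, 0 ≤ j < p
InCircuit : ∀ {k n} → Tuple k n → ℕ → Tuple k n → Set
InCircuit a p b = ∃ λ j → (j < p) × (b ≡ shift j a)

NegasymCircuit : ∀ {k n} → Tuple k n → ℕ → Set
NegasymCircuit a p = ∃ λ x → ∃ λ y →
  InCircuit a p x × InCircuit a p y × (x ≡ map negZ (reverse y))

{-# OPTIONS --safe #-}
-- Read cyclically (indices mod n = m + 1), the edge shift j a is negasymmetric iff a_x = −a_y
-- whenever x + y ≡ m + 2j, i.e. iff a is negasymmetric about the centre m + 2j. Two centres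
-- e and e + d make d a period of a, and a period p moves a centre by p. So if c = 2h is the
-- least period, a negasymmetric edge at offset j yields another at offset j + h, different
-- from it because h is not a period; and negasymmetric edges at offsets i < j < c give the
-- period 2(j − i), which c divides, forcing j − i = h.
module Submission where

open import Defs
open import Data.Nat using (ℕ; _≤_; _/_; zero; suc; _+_; _*_; _<_; _%_; NonZero; >-nonZero;
  s≤s; z≤n; z<s; s<s; s≤s⁻¹; compare; less; equal; greater)
open import Data.Nat.Divisibility using (_∣_; divides; m%n≡0⇒n∣m)
open import Data.Product using (∃; _×_; _,_; proj₁; proj₂)
open import Data.Sum using (_⊎_; inj₁; inj₂)
open import Relation.Binary.PropositionalEquality using (_≡_; _≢_; refl; sym; trans; cong; subst;
  module ≡-Reasoning)

open import Data.Nat.Properties using (+-identityʳ; +-assoc; +-comm; +-suc; *-comm; m+[n∸m]≡n;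
  m≤n+m; +-monoʳ-≤; ≤-<-trans; <⇒≱; *-monoˡ-<; *-cancelʳ-<; *-cancelʳ-≡; m<m*n; module ≤-Reasoning)
open import Data.Nat.DivMod using (m%n<n; m≡m%n+[m/n]*n; [m+kn]%n≡m%n; m<n⇒m%n≡m; m*n/n≡m)
open import Data.Nat.Tactic.RingSolver using (solve)
open import Data.Fin using (Fin; toℕ; fromℕ; fromℕ<; inject₁; opposite)
open import Data.Fin.Properties using (toℕ-injective; toℕ-fromℕ<; toℕ<n; opposite-prop; opposite-involutive)
open import Data.List using ([]; _∷_)
import Data.Vec as Vec
open import Data.Vec using (Vec; lookup; tabulate; reverse; _∷ʳ_)
open import Data.Vec.Properties using (lookup∘tabulate; tabulate∘lookup; tabulate-cong; lookup-map; reverse-∷)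
open import Data.Empty using (⊥-elim)

private variable
  A : Set
  k m n d e h j : ℕ

lookup-ext : {u v : Vec A n} → (∀ i → lookup u i ≡ lookup v i) → u ≡ v
lookup-ext {u = u} {v} eq = trans (sym (tabulate∘lookup u)) (trans (tabulate-cong eq) (tabulate∘lookup v))

lookup-∷ʳ-last : ∀ a (xs : Vec A n) → lookup (xs ∷ʳ a) (fromℕ n) ≡ a
lookup-∷ʳ-last a Vec.[] = refl
lookup-∷ʳ-last a (_ Vec.∷ xs) = lookup-∷ʳ-last a xs

lookup-∷ʳ-inject₁ : ∀ a (xs : Vec A n) i → lookup (xs ∷ʳ a) (inject₁ i) ≡ lookup xs i
lookup-∷ʳ-inject₁ a (_ Vec.∷ xs) Fin.zero = refl
lookup-∷ʳ-inject₁ a (_ Vec.∷ xs) (Fin.suc i) = lookup-∷ʳ-inject₁ a xs i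

lookup-reverse-opposite : ∀ (xs : Vec A n) i → lookup (reverse xs) (opposite i) ≡ lookup xs i
lookup-reverse-opposite (a Vec.∷ xs) i rewrite reverse-∷ a xs with i
... | Fin.zero = lookup-∷ʳ-last a (reverse xs)
... | Fin.suc i = trans (lookup-∷ʳ-inject₁ a (reverse xs) (opposite i)) (lookup-reverse-opposite xs i)

lookup-reverse : ∀ (xs : Vec A n) i → lookup (reverse xs) i ≡ lookup xs (opposite i)
lookup-reverse xs i =
  trans (cong (lookup (reverse xs)) (sym (opposite-involutive i))) (lookup-reverse-opposite xs (opposite i))

index : ℕ → Fin (suc m)
index {m} x = fromℕ< (m%n<n x (suc m))

-- Opaque so that unification can read u and x off a term at u x.
opaque
  at : Vec A (suc m) → ℕ → A
  at u x = lookup u (index x)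

  lookup-index : ∀ (u : Vec A (suc m)) x → lookup u (index x) ≡ at u x
  lookup-index u x = refl

  lookup≡at : ∀ (u : Vec A (suc m)) i → lookup u i ≡ at u (toℕ i)
  lookup≡at u i = cong (lookup u) (toℕ-injective (sym (trans (toℕ-fromℕ< _) (m<n⇒m%n≡m (toℕ<n i)))))

  at-+* : ∀ (u : Vec A (suc m)) x t → at u (x + t * suc m) ≡ at u x
  at-+* {m = m} u x t =
    cong (lookup u) (toℕ-injective (trans (toℕ-fromℕ< _) (trans ([m+kn]%n≡m%n x t (suc m)) (sym (toℕ-fromℕ< _)))))

at-cong : ∀ (u : Vec A (suc m)) {x y} s t → x + s * suc m ≡ y + t * suc m → at u x ≡ at u y
at-cong {m = m} u {x} {y} s t eq = begin
  at u x               ≡⟨ at-+* u x s ⟨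
  at u (x + s * suc m) ≡⟨ cong (at u) eq ⟩
  at u (y + t * suc m) ≡⟨ at-+* u y t ⟩
  at u y               ∎
  where open ≡-Reasoning

index-+-quotient : ∀ x → toℕ (index {m} x) + x / suc m * suc m ≡ x
index-+-quotient {m} x = trans (cong (_+ x / suc m * suc m) (toℕ-fromℕ< _)) (sym (m≡m%n+[m/n]*n x (suc m)))

at-index+ : ∀ (u : Vec A (suc m)) x d → at u (toℕ (index {m} x) + d) ≡ at u (x + d)
at-index+ {m = m} u x d = at-cong u (x / suc m) 0 (begin
  toℕ (index x) + d + x / suc m * suc m ≡⟨ move-d (toℕ (index x)) (x / suc m) ⟩
  toℕ (index x) + x / suc m * suc m + d ≡⟨ cong (_+ d) (index-+-quotient x) ⟩
  x + d                                 ≡⟨ +-identityʳ (x + d) ⟨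
  x + d + 0                             ∎)
  where
  open ≡-Reasoning
  move-d : ∀ r q → r + d + q * suc m ≡ r + q * suc m + d
  move-d r q = solve (r ∷ d ∷ q ∷ m ∷ [])

lookup-addMod : ∀ (u : Vec A (suc m)) i d → lookup u (addMod i d) ≡ at u (toℕ i + d)
lookup-addMod u i d = lookup-index u (toℕ i + d)

at-shift : ∀ j (u : Tuple k (suc m)) x → at (shift j u) x ≡ at u (x + j)
at-shift j u x = begin
  at (shift j u) x              ≡⟨ lookup-index (shift j u) x ⟨
  lookup (shift j u) (index x)  ≡⟨ lookup∘tabulate (λ i → lookup u (addMod i j)) (index x) ⟩
  lookup u (addMod (index x) j) ≡⟨ lookup-addMod u (index x) j ⟩
  at u (toℕ (index x) + j)      ≡⟨ at-index+ u x j ⟩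
  at u (x + j)                  ∎
  where open ≡-Reasoning

HasPeriod : Vec A (suc m) → ℕ → Set
HasPeriod u d = ∀ x → at u (x + d) ≡ at u x

periodic⇒hasPeriod : {u : Tuple k (suc m)} → Periodic u d → HasPeriod u d
periodic⇒hasPeriod {d = d} {u = u} p x = sym (begin
  at u x                        ≡⟨ lookup-index u x ⟨
  lookup u (index x)            ≡⟨ p (index x) ⟩
  lookup u (addMod (index x) d) ≡⟨ lookup-addMod u (index x) d ⟩
  at u (toℕ (index x) + d)      ≡⟨ at-index+ u x d ⟩
  at u (x + d)                  ∎)
  where open ≡-Reasoning

hasPeriod⇒periodic : {u : Tuple k (suc m)} → HasPeriod u d → Periodic u d
hasPeriod⇒periodic {d = d} {u = u} p i = begin
  lookup u i            ≡⟨ lookup≡at u i ⟩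
  at u (toℕ i)          ≡⟨ p (toℕ i) ⟨
  at u (toℕ i + d)      ≡⟨ lookup-addMod u i d ⟨
  lookup u (addMod i d) ∎
  where open ≡-Reasoning

hasPeriod-* : {u : Vec A (suc m)} → HasPeriod u d → ∀ t x → at u (x + t * d) ≡ at u x
hasPeriod-* {u = u} p zero x = cong (at u) (+-identityʳ x)
hasPeriod-* {d = d} {u = u} p (suc t) x = begin
  at u (x + suc t * d) ≡⟨ cong (at u) (solve (x ∷ d ∷ t ∷ [])) ⟩
  at u (x + t * d + d) ≡⟨ p (x + t * d) ⟩
  at u (x + t * d)     ≡⟨ hasPeriod-* p t x ⟩
  at u x               ∎
  where open ≡-Reasoning

hasPeriod-% : {u : Vec A (suc m)} {c : ℕ} .{{_ : NonZero c}} →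
              HasPeriod u c → HasPeriod u d → HasPeriod u (d % c)
hasPeriod-% {d = d} {u = u} {c} pc pd x = begin
  at u (x + d % c)               ≡⟨ hasPeriod-* pc (d / c) (x + d % c) ⟨
  at u (x + d % c + d / c * c)   ≡⟨ cong (at u) (+-assoc x (d % c) (d / c * c)) ⟩
  at u (x + (d % c + d / c * c)) ≡⟨ cong (λ y → at u (x + y)) (m≡m%n+[m/n]*n d c) ⟨
  at u (x + d)                   ≡⟨ pd x ⟩
  at u x                         ∎
  where open ≡-Reasoning

leastPeriod-∣ : {u : Tuple k (suc m)} {c : ℕ} → IsPeriod u c → HasPeriod u d → c ∣ d
leastPeriod-∣ {d = d} {c = suc c} (z<s , periodic , least) p with d % suc c in d%c≡r
... | zero = m%n≡0⇒n∣m d (suc c) d%c≡r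
... | suc _ = ⊥-elim (<⇒≱ (m%n<n d (suc c))
                (least (d % suc c) (subst (0 <_) (sym d%c≡r) z<s)
                  (hasPeriod⇒periodic (hasPeriod-% (periodic⇒hasPeriod periodic) p))))

m∣n⇒0<n⇒n<m*2⇒n≡m : m ∣ n → 0 < n → n < m * 2 → n ≡ m
m∣n⇒0<n⇒n<m*2⇒n≡m (divides 0 refl) () _
m∣n⇒0<n⇒n<m*2⇒n≡m {m} (divides 1 refl) _ _ = +-identityʳ m
m∣n⇒0<n⇒n<m*2⇒n≡m {m} (divides (suc (suc q)) refl) _ n<m*2 = ⊥-elim (<⇒≱ n<m*2 (begin
  m * 2           ≡⟨ *-comm m 2 ⟩
  m + (m + 0)     ≤⟨ +-monoʳ-≤ m (+-monoʳ-≤ m z≤n) ⟩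
  m + (m + q * m) ∎))
  where open ≤-Reasoning

-- m * x represents −x modulo suc m, so this says u_x = −u_y whenever x + y ≡ e (mod suc m).
NegasymAbout : Tuple k (suc m) → ℕ → Set
NegasymAbout {m = m} u e = ∀ x → at u x ≡ negZ (at u (e + m * x))

negasymAbout-from-lookup : {u : Tuple k (suc m)} →
  (∀ i → lookup u i ≡ negZ (at u (e + m * toℕ i))) → NegasymAbout u e
negasymAbout-from-lookup {m = m} {e = e} {u = u} r x = begin
  at u x                              ≡⟨ lookup-index u x ⟨
  lookup u (index x)                  ≡⟨ r (index x) ⟩
  negZ (at u (e + m * toℕ (index x))) ≡⟨ cong negZ (at-cong u (m * (x / suc m)) 0 reduce) ⟩
  negZ (at u (e + m * x))             ∎
  where
  open ≡-Reasoning
  distrib : ∀ r q → e + m * r + m * q * suc m ≡ e + m * (r + q * suc m)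
  distrib r q = solve (e ∷ m ∷ r ∷ q ∷ [])
  reduce : e + m * toℕ (index x) + m * (x / suc m) * suc m ≡ e + m * x + 0
  reduce = trans (distrib (toℕ (index x)) (x / suc m))
    (trans (cong (λ y → e + m * y) (index-+-quotient x)) (sym (+-identityʳ _)))

at-opposite : ∀ (u : Vec A (suc m)) i → at u (toℕ (opposite i)) ≡ at u (m + m * toℕ i)
at-opposite {m = m} u i = at-cong u (toℕ i) 0 (begin
  toℕ (opposite i) + toℕ i * suc m     ≡⟨ regroup (toℕ (opposite i)) (toℕ i) ⟩
  toℕ i + toℕ (opposite i) + m * toℕ i ≡⟨ cong (_+ m * toℕ i) i+opposite ⟩
  m + m * toℕ i                        ≡⟨ +-identityʳ _ ⟨
  m + m * toℕ i + 0                    ∎)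
  where
  open ≡-Reasoning
  regroup : ∀ o r → o + r * suc m ≡ r + o + m * r
  regroup o r = solve (o ∷ r ∷ m ∷ [])
  i+opposite : toℕ i + toℕ (opposite i) ≡ m
  i+opposite = trans (cong (toℕ i +_) (opposite-prop i)) (m+[n∸m]≡n (s≤s⁻¹ (toℕ<n i)))

lookup-negReverse : ∀ (u : Tuple k (suc m)) i →
  lookup (Vec.map negZ (reverse u)) i ≡ negZ (at u (m + m * toℕ i))
lookup-negReverse {m = m} u i = begin
  lookup (Vec.map negZ (reverse u)) i ≡⟨ lookup-map i negZ (reverse u) ⟩
  negZ (lookup (reverse u) i)         ≡⟨ cong negZ (lookup-reverse u i) ⟩
  negZ (lookup u (opposite i))        ≡⟨ cong negZ (lookup≡at u (opposite i)) ⟩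
  negZ (at u (toℕ (opposite i)))      ≡⟨ cong negZ (at-opposite u i) ⟩
  negZ (at u (m + m * toℕ i))         ∎
  where open ≡-Reasoning

negasym⇒negasymAbout : {u : Tuple k (suc m)} → Negasym u → NegasymAbout u m
negasym⇒negasymAbout {u = u} nu = negasymAbout-from-lookup λ i →
  trans (cong (λ v → lookup v i) nu) (lookup-negReverse u i)

negasymAbout⇒negasym : {u : Tuple k (suc m)} → NegasymAbout u m → Negasym u
negasymAbout⇒negasym {u = u} r = lookup-ext λ i →
  trans (lookup≡at u i) (trans (r (toℕ i)) (sym (lookup-negReverse u i)))

negasymAbout-unshift : {a : Tuple k (suc m)} → NegasymAbout (shift j a) e → NegasymAbout a (e + j * 2)
negasymAbout-unshift {m = m} {j = j} {e = e} {a = a} r y = begin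
  at a y                                      ≡⟨ at-cong a j 0 (solve (y ∷ j ∷ m ∷ [])) ⟩
  at a (y + m * j + j)                        ≡⟨ at-shift j a (y + m * j) ⟨
  at (shift j a) (y + m * j)                  ≡⟨ r (y + m * j) ⟩
  negZ (at (shift j a) (e + m * (y + m * j))) ≡⟨ cong negZ (at-shift j a _) ⟩
  negZ (at a (e + m * (y + m * j) + j))       ≡⟨ cong negZ (at-cong a j (m * j) (solve (e ∷ y ∷ j ∷ m ∷ []))) ⟩
  negZ (at a (e + j * 2 + m * y))             ∎
  where open ≡-Reasoning

negasymAbout-shift : {a : Tuple k (suc m)} → NegasymAbout a (e + j * 2) → NegasymAbout (shift j a) e
negasymAbout-shift {m = m} {e = e} {j = j} {a = a} r x = begin
  at (shift j a) x                      ≡⟨ at-shift j a x ⟩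
  at a (x + j)                          ≡⟨ r (x + j) ⟩
  negZ (at a (e + j * 2 + m * (x + j))) ≡⟨ cong negZ (at-cong a 0 j (solve (e ∷ x ∷ j ∷ m ∷ []))) ⟩
  negZ (at a (e + m * x + j))           ≡⟨ cong negZ (at-shift j a (e + m * x)) ⟨
  negZ (at (shift j a) (e + m * x))     ∎
  where open ≡-Reasoning

negasymAbout-+period : {a : Tuple k (suc m)} → HasPeriod a d → NegasymAbout a e → NegasymAbout a (e + d)
negasymAbout-+period {m = m} {d = d} {e = e} {a = a} p r x = begin
  at a x                      ≡⟨ r x ⟩
  negZ (at a (e + m * x))     ≡⟨ cong negZ (p (e + m * x)) ⟨
  negZ (at a (e + m * x + d)) ≡⟨ cong (λ y → negZ (at a y)) (solve (e ∷ m ∷ x ∷ d ∷ [])) ⟩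
  negZ (at a (e + d + m * x)) ∎
  where open ≡-Reasoning

negasymAbout-pair⇒period : {a : Tuple k (suc m)} → NegasymAbout a e → NegasymAbout a (e + d) → HasPeriod a d
negasymAbout-pair⇒period {m = m} {e = e} {d = d} {a = a} r r′ x = begin
  at a (x + d)                      ≡⟨ r′ (x + d) ⟩
  negZ (at a (e + d + m * (x + d))) ≡⟨ cong negZ (at-cong a 0 d (solve (e ∷ d ∷ m ∷ x ∷ []))) ⟩
  negZ (at a (e + m * x))           ≡⟨ r x ⟨
  at a x                            ∎
  where open ≡-Reasoning

shift-shift : ∀ h j (a : Tuple k (suc m)) → shift h (shift j a) ≡ shift (j + h) a
shift-shift h j a = tabulate-cong λ i → begin
  lookup (shift j a) (addMod i h) ≡⟨ lookup-addMod (shift j a) i h ⟩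
  at (shift j a) (toℕ i + h)      ≡⟨ at-shift j a (toℕ i + h) ⟩
  at a (toℕ i + h + j)            ≡⟨ cong (at a) (trans (+-assoc (toℕ i) h j) (cong (toℕ i +_) (+-comm h j))) ⟩
  at a (toℕ i + (j + h))          ≡⟨ lookup-addMod a i (j + h) ⟨
  lookup a (addMod i (j + h))     ∎
  where open ≡-Reasoning

shift-+period : {a : Tuple k (suc m)} → HasPeriod a d → shift (j + d) a ≡ shift j a
shift-+period {d = d} {j = j} {a = a} p = tabulate-cong λ i → begin
  lookup a (addMod i (j + d)) ≡⟨ lookup-addMod a i (j + d) ⟩
  at a (toℕ i + (j + d))      ≡⟨ cong (at a) (+-assoc (toℕ i) j d) ⟨
  at a (toℕ i + j + d)        ≡⟨ p (toℕ i + j) ⟩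
  at a (toℕ i + j)            ≡⟨ lookup-addMod a i j ⟨
  lookup a (addMod i j)       ∎
  where open ≡-Reasoning

shift≡shift⇒period : {a : Tuple k (suc m)} → shift j a ≡ shift (j + d) a → HasPeriod a d
shift≡shift⇒period {m = m} {j = j} {d = d} {a = a} eq x = begin
  at a (x + d)                     ≡⟨ at-cong a j 0 (solve (x ∷ d ∷ j ∷ m ∷ [])) ⟩
  at a (x + m * j + (j + d))       ≡⟨ at-shift (j + d) a (x + m * j) ⟨
  at (shift (j + d) a) (x + m * j) ≡⟨ cong (λ v → at v (x + m * j)) eq ⟨
  at (shift j a) (x + m * j)       ≡⟨ at-shift j a (x + m * j) ⟩
  at a (x + m * j + j)             ≡⟨ at-cong a 0 j (solve (x ∷ j ∷ m ∷ [])) ⟩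
  at a x                           ∎
  where open ≡-Reasoning

negasym-shift⇒negasymAbout : ∀ j {a : Tuple k (suc m)} → Negasym (shift j a) → NegasymAbout a (m + j * 2)
negasym-shift⇒negasymAbout j n = negasymAbout-unshift {j = j} (negasym⇒negasymAbout n)

negasymAbout⇒negasym-shift : ∀ j {a : Tuple k (suc m)} → NegasymAbout a (m + j * 2) → Negasym (shift j a)
negasymAbout⇒negasym-shift j r = negasymAbout⇒negasym (negasymAbout-shift {j = j} r)

negasym-shift-+half : ∀ j {a : Tuple k (suc m)} → HasPeriod a (h * 2) →
  Negasym (shift j a) → Negasym (shift (j + h) a)
negasym-shift-+half {m = m} {h = h} j {a} p n = negasymAbout⇒negasym-shift (j + h)
  (subst (NegasymAbout a) centre (negasymAbout-+period p (negasym-shift⇒negasymAbout j n)))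
  where
  centre : m + j * 2 + h * 2 ≡ m + (j + h) * 2
  centre = solve (m ∷ j ∷ h ∷ [])

negasym-shifts⇒period : ∀ i t {a : Tuple k (suc m)} →
  Negasym (shift i a) → Negasym (shift (i + t) a) → HasPeriod a (t * 2)
negasym-shifts⇒period {m = m} i t {a} ni nit = negasymAbout-pair⇒period (negasym-shift⇒negasymAbout i ni)
  (subst (NegasymAbout a) centre (negasym-shift⇒negasymAbout (i + t) nit))
  where
  centre : m + (i + t) * 2 ≡ m + i * 2 + t * 2
  centre = solve (m ∷ i ∷ t ∷ [])

module _ {k m h : ℕ} (a : Tuple k (suc m)) (least : IsPeriod a (h * 2)) where

  leastPeriod-hasPeriod : HasPeriod a (h * 2)
  leastPeriod-hasPeriod = periodic⇒hasPeriod {u = a} (proj₁ (proj₂ least))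

  half-period-positive : 0 < h
  half-period-positive = *-cancelʳ-< 2 0 h (proj₁ least)

  shift≢shift-+half : ∀ j → shift j a ≢ shift (j + h) a
  shift≢shift-+half j eq = <⇒≱ (m<m*n h 2 ⦃ >-nonZero half-period-positive ⦄ (s<s z<s))
    (proj₂ (proj₂ least) h half-period-positive (hasPeriod⇒periodic (shift≡shift⇒period {a = a} eq)))

  negasym-shifts-offset≡half : ∀ i t → Negasym (shift i a) → Negasym (shift (i + t) a) →
    0 < t → t < h * 2 → t ≡ h
  negasym-shifts-offset≡half i t ni nit 0<t t<c = *-cancelʳ-≡ t h 2
    (m∣n⇒0<n⇒n<m*2⇒n≡m (leastPeriod-∣ least (negasym-shifts⇒period i t {a} ni nit))
      (*-monoˡ-< 2 0<t) (*-monoˡ-< 2 t<c))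

  shift-half-twice : ∀ i → shift h (shift h (shift i a)) ≡ shift i a
  shift-half-twice i = begin
    shift h (shift h (shift i a)) ≡⟨ cong (shift h) (shift-shift h i a) ⟩
    shift h (shift (i + h) a)     ≡⟨ shift-shift h (i + h) a ⟩
    shift (i + h + h) a           ≡⟨ cong (λ s → shift s a) (solve (i ∷ h ∷ [])) ⟩
    shift (i + h * 2) a           ≡⟨ shift-+period leastPeriod-hasPeriod ⟩
    shift i a                     ∎
    where open ≡-Reasoning

  negasym-shifts-half-apart : ∀ i d → suc (i + d) < h * 2 →
    Negasym (shift i a) → Negasym (shift (suc (i + d)) a) → shift (suc (i + d)) a ≡ shift h (shift i a)
  negasym-shifts-half-apart i d 1+i+d<c ni nj = begin
    shift (suc (i + d)) a ≡⟨ cong (λ s → shift s a) (trans (sym (+-suc i d)) (cong (i +_) 1+d≡h)) ⟩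
    shift (i + h) a       ≡⟨ shift-shift h i a ⟨
    shift h (shift i a)   ∎
    where
    open ≡-Reasoning
    1+d≡h : suc d ≡ h
    1+d≡h = negasym-shifts-offset≡half i (suc d) ni (subst (λ s → Negasym (shift s a)) (sym (+-suc i d)) nj)
      z<s (≤-<-trans (s≤s (m≤n+m d i)) 1+i+d<c)

  negasym-shifts-cases : ∀ {i j} → i < h * 2 → j < h * 2 → Negasym (shift i a) → Negasym (shift j a) →
    shift j a ≡ shift i a ⊎ shift j a ≡ shift h (shift i a)
  negasym-shifts-cases {i} {j} i<c j<c ni nj with compare i j
  ... | equal _     = inj₁ refl
  ... | less _ d    = inj₂ (negasym-shifts-half-apart i d j<c ni nj)
  ... | greater _ d =
    inj₂ (sym (trans (cong (shift h) (negasym-shifts-half-apart j d i<c nj ni)) (shift-half-twice j)))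

lemma4p6 : (k n : ℕ) → 3 ≤ k → 4 ≤ n → 2 ∣ n →
    (a : Tuple k n) → InH a →
    (c : ℕ) → IsPeriod a c → 2 ∣ c →
    NegasymCircuit a c →
    (∃ λ u → InCircuit a c u × Negasym u) →
    ∃ λ u → InCircuit a c u × Negasym u × Negasym (shift (c / 2) u)
      × (u ≢ shift (c / 2) u)
      × (∀ v → InCircuit a c v → Negasym v → (v ≡ u) ⊎ (v ≡ shift (c / 2) u))
lemma4p6 k (suc m) _ (s≤s _) _ a _ .(h * 2) least (divides h refl) _ (_ , (j , j<c , refl) , nu)
  rewrite m*n/n≡m h 2 ⦃ _ ⦄ =
  shift j a , (j , j<c , refl) , nu , negasym-half , half≢ , unique
  where
  negasym-half : Negasym (shift h (shift j a))
  negasym-half = subst Negasym (sym (shift-shift h j a))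
    (negasym-shift-+half j (leastPeriod-hasPeriod {h = h} a least) nu)
  half≢ : shift j a ≢ shift h (shift j a)
  half≢ eq = shift≢shift-+half a least j (trans eq (shift-shift h j a))
  unique : ∀ v → InCircuit a (h * 2) v → Negasym v → v ≡ shift j a ⊎ v ≡ shift h (shift j a)
  unique _ (s , s<c , refl) nv = negasym-shifts-cases a least j<c s<c nu nv
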